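{- Let $k\ge 2$ and let $n_1,\dots,n_k\ge 2$ be integers. Let $G=G_{n_1,\dots,n_k}$ be the graph whose vertex set is a disjoint union $V_1\sqcup\cdots\sqcup V_k$ with $|V_i|=n_i$, in which every vertex of $V_i$ is adjacent to every vertex of $V_{i+1}$ for $i=1,\dots,k-1$, and there are no other edges. Put $N_1=n_2$, $N_k=n_{k-1}$, and $N_i=n_{i-1}+n_{i+1}$ for $2\le i\le k-1$. Let $L_3$ be the $2k\times 2k$ integer matrix with rows and columns indexed by $1,\dots,2k$ whose only nonzero entries are: $(L_3)_{2i-1,2i-1}=(L_3)_{2i,2i}=N_i$ for $1\le i\le k$; $(L_3)_{2i-1,2i+1}=-n_{i+1}$ and $(L_3)_{2i-1,2i+2}=-1$ for $1\le i\le k-1$; $(L_3)_{2i-1,2i-3}=-n_{i-1}$ and $(L_3)_{2i-1,2i-2}=-1$ for $2\le i\le k$. Then $$\mathbb{Z}\oplus K(G)\cong\Big(\bigoplus_{i=1}^{k}(\mathbb{Z}/N_i\mathbb{Z})^{\oplus(n_i-2)}\Big)\oplus \operatorname{coker}L_3,$$ where $\operatorname{coker}L_3=\mathbb{Z}^{2k}/L_3\mathbb{Z}^{2k}$.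
   Context: For a finite connected graph $G=(V,E)$, its Laplacian $L(G)$ is the $|V|\times|V|$ matrix with $L(G)_{vv}=\deg v$, $L(G)_{uv}=-1$ if $u\ne v$ are adjacent, and $0$ otherwise. Viewing $L(G)$ as a map $\mathbb{Z}^{V}\to\mathbb{Z}^{V}$, its cokernel has the form $\mathbb{Z}^V/\operatorname{im}L(G)\cong\mathbb{Z}\oplus K(G)$ with $K(G)$ a finite abelian group, called the critical group of $G$. $(\mathbb{Z}/m\mathbb{Z})^{\oplus r}$ denotes the direct sum of $r$ copies of $\mathbb{Z}/m\mathbb{Z}$. -}

module Defs where

open import Data.Nat as ℕ using (ℕ; zero; suc)
open import Data.Fin as F using (Fin; toℕ)
open import Data.Integer as ℤ using (ℤ; +_; -_)
open import Data.Sum using (_⊎_; inj₁; inj₂)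
open import Data.Product using (Σ; _,_; ∃)
open import Data.Bool using (Bool; true; false; if_then_else_; _∧_; _∨_)
open import Relation.Nullary using (yes; no)
open import Relation.Nullary.Decidable using (⌊_⌋)
open import Relation.Binary.PropositionalEquality using (_≡_; refl)

data FT : Set where
  fin : ℕ → FT
  _⊞_ : FT → FT → FT
  sig : (k : ℕ) → (Fin k → FT) → FT

El : FT → Set
El (fin n)   = Fin n
El (a ⊞ b)   = El a ⊎ El b
El (sig k f) = Σ (Fin k) (λ i → El (f i))

sumFin : (n : ℕ) → (Fin n → ℤ) → ℤ
sumFin zero    f = + 0
sumFin (suc n) f = f F.zero ℤ.+ sumFin n (λ i → f (F.suc i))

sumFT : (t : FT) → (El t → ℤ) → ℤ
sumFT (fin n)   f = sumFin n f
sumFT (a ⊞ b)   f = sumFT a (λ x → f (inj₁ x)) ℤ.+ sumFT b (λ y → f (inj₂ y))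
sumFT (sig k g) f = sumFin k (λ i → sumFT (g i) (λ x → f (i , x)))

eqEl : (t : FT) → El t → El t → Bool
eqEl (fin n)   a b = ⌊ a F.≟ b ⌋
eqEl (a ⊞ b)   (inj₁ x) (inj₁ y) = eqEl a x y
eqEl (a ⊞ b)   (inj₁ x) (inj₂ y) = false
eqEl (a ⊞ b)   (inj₂ x) (inj₁ y) = false
eqEl (a ⊞ b)   (inj₂ x) (inj₂ y) = eqEl b x y
eqEl (sig k g) (i , x) (j , y) with i F.≟ j
... | yes refl = eqEl (g i) x y
... | no _     = false

-- Finitely presented abelian groups: the cokernel of an integer matrix
-- M : ℤ^rel → ℤ^gen,  (M z)_g = Σ_r M g r * z r.

record Pres : Set where
  field
    gen : FT
    rel : FT
    mat : El gen → El rel → ℤ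
open Pres public

Vec : Pres → Set
Vec P = El (gen P) → ℤ

_+v_ : {P : Pres} → Vec P → Vec P → Vec P
(x +v y) g = x g ℤ.+ y g

-- x ∼ y  iff  x - y ∈ im M  (equality in coker M = ℤ^gen / M ℤ^rel)
Eqv : (P : Pres) → Vec P → Vec P → Set
Eqv P x y = ∃ λ (z : El (rel P) → ℤ) →
  ∀ g → x g ℤ.- y g ≡ sumFT (rel P) (λ r → mat P g r ℤ.* z r)

syntax Eqv P x y = x ∼⟨ P ⟩ y

-- A group isomorphism  coker P ≅ coker Q, given on representatives:
-- well-defined homomorphisms in both directions, mutually inverse.
record _≅_ (P Q : Pres) : Set where
  field
    to      : Vec P → Vec Q
    from    : Vec Q → Vec P
    to-cong   : ∀ x y → x ∼⟨ P ⟩ y → to x ∼⟨ Q ⟩ to y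
    from-cong : ∀ x y → x ∼⟨ Q ⟩ y → from x ∼⟨ P ⟩ from y
    to-hom    : ∀ x y → to (_+v_ {P} x y) ∼⟨ Q ⟩ (_+v_ {Q} (to x) (to y))
    from-hom  : ∀ x y → from (_+v_ {Q} x y) ∼⟨ P ⟩ (_+v_ {P} (from x) (from y))
    from-to   : ∀ x → from (to x) ∼⟨ P ⟩ x
    to-from   : ∀ y → to (from y) ∼⟨ Q ⟩ y

ZMod : ℕ → Pres
ZMod N = record { gen = fin 1 ; rel = fin 1 ; mat = λ _ _ → + N }

_⊕_ : Pres → Pres → Pres
P ⊕ Q = record
  { gen = gen P ⊞ gen Q
  ; rel = rel P ⊞ rel Q
  ; mat = m }
  where
  m : El (gen P ⊞ gen Q) → El (rel P ⊞ rel Q) → ℤ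
  m (inj₁ a) (inj₁ b) = mat P a b
  m (inj₁ a) (inj₂ b) = + 0
  m (inj₂ a) (inj₁ b) = + 0
  m (inj₂ a) (inj₂ b) = mat Q a b

⨁ : (k : ℕ) → (Fin k → Pres) → Pres
⨁ k P = record
  { gen = sig k (λ i → gen (P i))
  ; rel = sig k (λ i → rel (P i))
  ; mat = m }
  where
  m : El (sig k (λ i → gen (P i))) → El (sig k (λ i → rel (P i))) → ℤ
  m (i , a) (j , b) with i F.≟ j
  ... | yes refl = mat (P i) a b
  ... | no _     = + 0

_^⊕_ : Pres → ℕ → Pres
P ^⊕ r = ⨁ r (λ _ → P)

cokerMat : (m : ℕ) → (Fin m → Fin m → ℤ) → Pres
cokerMat m M = record { gen = fin m ; rel = fin m ; mat = M }

-- Graph Laplacian of a finite simple graph on vertex set El V,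
-- given by a symmetric irreflexive adjacency predicate.
-- Its cokernel  ℤ^V / im L  is (by the definition of K(G))  ℤ ⊕ K(G).

b2z : Bool → ℤ
b2z true  = + 1
b2z false = + 0

degree : (V : FT) → (El V → El V → Bool) → El V → ℤ
degree V adj u = sumFT V (λ v → b2z (adj u v))

laplacian : (V : FT) → (El V → El V → Bool) → El V → El V → ℤ
laplacian V adj u v =
  if eqEl V u v then degree V adj u
  else (if adj u v then - (+ 1) else + 0)

lapPres : (V : FT) → (El V → El V → Bool) → Pres
lapPres V adj = record { gen = V ; rel = V ; mat = laplacian V adj }

-- The graph G_{n_1,...,n_k}.  Part i (0-based index i : Fin k) has
-- n i vertices; vertex (i , a).  (i,a) ~ (j,b) iff |i - j| = 1.

Gverts : (k : ℕ) → (Fin k → ℕ) → FT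
Gverts k n = sig k (λ i → fin (n i))

Gadj : (k : ℕ) (n : Fin k → ℕ) → El (Gverts k n) → El (Gverts k n) → Bool
Gadj k n (i , a) (j , b) =
  ⌊ suc (toℕ i) ℕ.≟ toℕ j ⌋ ∨ ⌊ suc (toℕ j) ℕ.≟ toℕ i ⌋

-- 1-based access n_i (i = 1..k), padded with 0 outside 1..k
nAt : (k : ℕ) → (Fin k → ℕ) → ℕ → ℕ
nAt k n zero = 0
nAt k n (suc i) with i ℕ.<? k
... | yes p = n (F.fromℕ< p)
... | no _  = 0

NN : (k : ℕ) → (Fin k → ℕ) → ℕ → ℕ
NN k n i =
  if ⌊ i ℕ.≟ 1 ⌋ then nAt k n 2
  else (if ⌊ i ℕ.≟ k ⌋ then nAt k n (k ℕ.∸ 1)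
  else nAt k n (i ℕ.∸ 1) ℕ.+ nAt k n (i ℕ.+ 1))

[_] : Bool → ℤ
[ b ] = b2z b

_==_ : ℕ → ℕ → Bool
p == q = ⌊ p ℕ.≟ q ⌋

-- entry (p , q) of L_3, with 1-based p q ∈ {1..2k}:
-- the sum over i = 1..k of the listed nonzero entries.
L3entry : (k : ℕ) → (Fin k → ℕ) → ℕ → ℕ → ℤ
L3entry k n p q = sumFin k (λ j → term (suc (toℕ j)))
  where
  term : ℕ → ℤ
  term i =
      [ (p == (2 ℕ.* i ℕ.∸ 1)) ∧ (q == (2 ℕ.* i ℕ.∸ 1)) ] ℤ.* + NN k n i
    ℤ.+ [ (p == (2 ℕ.* i)) ∧ (q == (2 ℕ.* i)) ] ℤ.* + NN k n i
    ℤ.+ [ ⌊ i ℕ.≤? k ℕ.∸ 1 ⌋ ] ℤ.*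
        (   [ (p == (2 ℕ.* i ℕ.∸ 1)) ∧ (q == (2 ℕ.* i ℕ.+ 1)) ] ℤ.* - (+ nAt k n (i ℕ.+ 1))
        ℤ.+ [ (p == (2 ℕ.* i ℕ.∸ 1)) ∧ (q == (2 ℕ.* i ℕ.+ 2)) ] ℤ.* - (+ 1))
    ℤ.+ [ ⌊ 2 ℕ.≤? i ⌋ ] ℤ.*
        (   [ (p == (2 ℕ.* i ℕ.∸ 1)) ∧ (q == (2 ℕ.* i ℕ.∸ 3)) ] ℤ.* - (+ nAt k n (i ℕ.∸ 1))
        ℤ.+ [ (p == (2 ℕ.* i ℕ.∸ 1)) ∧ (q == (2 ℕ.* i ℕ.∸ 2)) ] ℤ.* - (+ 1))

-- L_3 as a (2k)×(2k) matrix, Fin index a ↔ 1-based index toℕ a + 1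
L3 : (k : ℕ) → (Fin k → ℕ) → Fin (2 ℕ.* k) → Fin (2 ℕ.* k) → ℤ
L3 k n a b = L3entry k n (suc (toℕ a)) (suc (toℕ b))

-- Write a vector v on a part V_i of size m in the coordinates
--   x = v₁,   y = v₀ − (m−1)v₁ + Σ_{a≥2} v_a,   d_a = v_a − v₁ (2 ≤ a < m),
-- a unimodular change of basis. On V_i the Laplacian acts as v ↦ N_i v − W, where W, the total
-- of the vector over the neighbouring parts, is constant on V_i. Hence it multiplies every d_a
-- and y by N_i, giving the summands (ℤ/N_i)^{n_i−2}, and sends x to N_i x − W. The total of
-- part j is n_j x_j + y_j, so in the coordinates (x₁, y₁, …, x_k, y_k) what remains is exactly
-- L₃. Applying the same change of basis to generators and relations preserves the cokernel.

module Submission where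

open import Data.Bool using (Bool; true; false; _∧_; _∨_)
open import Data.Empty using (⊥-elim)
open import Data.Fin as F using (Fin; toℕ)
import Data.Fin.Properties as FP
open import Data.Integer using (ℤ; +_; -_; _+_; _*_; _-_)
import Data.Integer.Properties as ℤP
open import Data.Integer.Tactic.RingSolver using (solve-∀)
open import Data.Nat as ℕ using (ℕ; zero; suc; _≤_; _<_; s≤s; z≤n)
import Data.Nat.Properties as ℕP
open import Data.Product using (Σ; _,_)
open import Data.Sum using (_⊎_; inj₁; inj₂)
open import Data.Sum.Properties using (inj₁-injective; inj₂-injective)
open import Function using (_∘_)
open import Relation.Nullary using (yes; no; ¬_; Dec)
open import Relation.Nullary.Decidable using (⌊_⌋)
open import Relation.Binary.PropositionalEquality hiding ([_])
open ≡-Reasoning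

open import Algebra.Properties.Semiring.Sum ℤP.+-*-semiring
  using (sum; sum-cong-≗; sum-replicate-zero; ∑-distrib-+; ∑-comm; *-distribˡ-sum; *-distribʳ-sum)

open import Defs

sumFin≡sum : ∀ n (f : Fin n → ℤ) → sumFin n f ≡ sum f
sumFin≡sum zero    f = refl
sumFin≡sum (suc n) f = cong (λ t → f F.zero + t) (sumFin≡sum n (λ i → f (F.suc i)))

sumFin-cong : ∀ n {f g : Fin n → ℤ} → (∀ i → f i ≡ g i) → sumFin n f ≡ sumFin n g
sumFin-cong n {f} {g} f≗g rewrite sumFin≡sum n f | sumFin≡sum n g = sum-cong-≗ f≗g

sumFin-zero : ∀ n (f : Fin n → ℤ) → (∀ i → f i ≡ + 0) → sumFin n f ≡ + 0
sumFin-zero n f f≗0 =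
  trans (sumFin-cong n f≗0) (trans (sumFin≡sum n (λ _ → + 0)) (sum-replicate-zero n))

sumFin-+ : ∀ n (f g : Fin n → ℤ) → sumFin n (λ i → f i + g i) ≡ sumFin n f + sumFin n g
sumFin-+ n f g
  rewrite sumFin≡sum n (λ i → f i + g i) | sumFin≡sum n f | sumFin≡sum n g = ∑-distrib-+ f g

sumFin-*ˡ : ∀ n c (f : Fin n → ℤ) → sumFin n (λ i → c * f i) ≡ c * sumFin n f
sumFin-*ˡ n c f
  rewrite sumFin≡sum n (λ i → c * f i) | sumFin≡sum n f = sym (*-distribˡ-sum c f)

sumFin-*ʳ : ∀ n c (f : Fin n → ℤ) → sumFin n (λ i → f i * c) ≡ sumFin n f * c
sumFin-*ʳ n c f
  rewrite sumFin≡sum n (λ i → f i * c) | sumFin≡sum n f = sym (*-distribʳ-sum c f)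

sumFin-swap : ∀ m n (f : Fin m → Fin n → ℤ) →
  sumFin m (λ i → sumFin n (f i)) ≡ sumFin n (λ j → sumFin m (λ i → f i j))
sumFin-swap m n f = begin
  sumFin m (λ i → sumFin n (f i))          ≡⟨ sumFin-cong m (λ i → sumFin≡sum n (f i)) ⟩
  sumFin m (λ i → sum (f i))               ≡⟨ sumFin≡sum m _ ⟩
  sum (λ i → sum (f i))                    ≡⟨ ∑-comm f ⟩
  sum (λ j → sum (λ i → f i j))            ≡⟨ sym (sumFin≡sum n _) ⟩
  sumFin n (λ j → sum (λ i → f i j))       ≡⟨ sumFin-cong n (λ j → sym (sumFin≡sum m _)) ⟩
  sumFin n (λ j → sumFin m (λ i → f i j))  ∎

sub-+-interchange : ∀ a b c d → a - b + (c - d) ≡ a + c - (b + d)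
sub-+-interchange = solve-∀

sumFin-sub : ∀ n (f g : Fin n → ℤ) → sumFin n (λ i → f i - g i) ≡ sumFin n f - sumFin n g
sumFin-sub zero    f g = refl
sumFin-sub (suc n) f g = trans
  (cong (λ t → f F.zero - g F.zero + t) (sumFin-sub n (λ i → f (F.suc i)) (λ i → g (F.suc i))))
  (sub-+-interchange (f F.zero) (g F.zero) _ _)

sumFin-const : ∀ n c → sumFin n (λ _ → c) ≡ + n * c
sumFin-const zero    c = sym (ℤP.*-zeroˡ c)
sumFin-const (suc n) c = trans (cong (_+_ c) (sumFin-const n c)) (sym (ℤP.suc-* (+ n) c))

sumFin-single : ∀ n (f : Fin n → ℤ) i → (∀ j → j ≢ i → f j ≡ + 0) → sumFin n f ≡ f i
sumFin-single (suc n) f F.zero off = begin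
  f F.zero + sumFin n (λ j → f (F.suc j))
    ≡⟨ cong (λ t → f F.zero + t) (sumFin-zero n _ (λ j → off (F.suc j) (λ ()))) ⟩
  f F.zero + + 0  ≡⟨ ℤP.+-identityʳ _ ⟩
  f F.zero        ∎
sumFin-single (suc n) f (F.suc i) off = begin
  f F.zero + sumFin n (λ j → f (F.suc j))
    ≡⟨ cong₂ _+_ (off F.zero (λ ())) (sumFin-single n _ i (λ j j≢i → off (F.suc j) (j≢i ∘ FP.suc-injective))) ⟩
  + 0 + f (F.suc i)  ≡⟨ ℤP.+-identityˡ _ ⟩
  f (F.suc i)        ∎

sumFT-cong : ∀ t {f g : El t → ℤ} → (∀ u → f u ≡ g u) → sumFT t f ≡ sumFT t g
sumFT-cong (fin n)   f≗g = sumFin-cong n f≗g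
sumFT-cong (a ⊞ b)   f≗g = cong₂ _+_ (sumFT-cong a (f≗g ∘ inj₁)) (sumFT-cong b (f≗g ∘ inj₂))
sumFT-cong (sig k g) f≗g = sumFin-cong k (λ i → sumFT-cong (g i) (λ x → f≗g (i , x)))

sumFT-zero : ∀ t (f : El t → ℤ) → (∀ u → f u ≡ + 0) → sumFT t f ≡ + 0
sumFT-zero (fin n)   f f≗0 = sumFin-zero n f f≗0
sumFT-zero (a ⊞ b)   f f≗0 = cong₂ _+_ (sumFT-zero a _ (f≗0 ∘ inj₁)) (sumFT-zero b _ (f≗0 ∘ inj₂))
sumFT-zero (sig k g) f f≗0 = sumFin-zero k _ (λ i → sumFT-zero (g i) _ (λ x → f≗0 (i , x)))

sumFT-sub : ∀ t (f g : El t → ℤ) → sumFT t (λ u → f u - g u) ≡ sumFT t f - sumFT t g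
sumFT-sub (fin n)   f g = sumFin-sub n f g
sumFT-sub (a ⊞ b)   f g =
  trans (cong₂ _+_ (sumFT-sub a (f ∘ inj₁) (g ∘ inj₁)) (sumFT-sub b (f ∘ inj₂) (g ∘ inj₂)))
        (sub-+-interchange (sumFT a (f ∘ inj₁)) _ _ _)
sumFT-sub (sig k h) f g =
  trans (sumFin-cong k (λ i → sumFT-sub (h i) (λ x → f (i , x)) (λ x → g (i , x)))) (sumFin-sub k _ _)

sumFT-single : ∀ t (f : El t → ℤ) u → (∀ v → v ≢ u → f v ≡ + 0) → sumFT t f ≡ f u
sumFT-single (fin n) f u off = sumFin-single n f u off
sumFT-single (a ⊞ b) f (inj₁ x) off = begin
  sumFT a (f ∘ inj₁) + sumFT b (f ∘ inj₂)
    ≡⟨ cong₂ _+_ (sumFT-single a _ x (λ y y≢x → off (inj₁ y) (y≢x ∘ inj₁-injective)))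
                 (sumFT-zero b _ (λ y → off (inj₂ y) (λ ()))) ⟩
  f (inj₁ x) + + 0  ≡⟨ ℤP.+-identityʳ _ ⟩
  f (inj₁ x)        ∎
sumFT-single (a ⊞ b) f (inj₂ x) off = begin
  sumFT a (f ∘ inj₁) + sumFT b (f ∘ inj₂)
    ≡⟨ cong₂ _+_ (sumFT-zero a _ (λ y → off (inj₁ y) (λ ())))
                 (sumFT-single b _ x (λ y y≢x → off (inj₂ y) (y≢x ∘ inj₂-injective))) ⟩
  + 0 + f (inj₂ x)  ≡⟨ ℤP.+-identityˡ _ ⟩
  f (inj₂ x)        ∎
sumFT-single (sig k g) f (i , x) off = trans
  (sumFin-single k _ i (λ j j≢i → sumFT-zero (g j) _ (λ y → off (j , y) (λ { refl → j≢i refl }))))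
  (sumFT-single (g i) _ x (λ y y≢x → off (i , y) (λ { refl → y≢x refl })))

==-true : ∀ {p q} → p ≡ q → (p == q) ≡ true
==-true {p} {q} p≡q with p ℕ.≟ q
... | yes _   = refl
... | no  p≢q = ⊥-elim (p≢q p≡q)

==-false : ∀ {p q} → p ≢ q → (p == q) ≡ false
==-false {p} {q} p≢q with p ℕ.≟ q
... | yes p≡q = ⊥-elim (p≢q p≡q)
... | no  _   = refl

==⇒≡ : ∀ {p q} → (p == q) ≡ true → p ≡ q
==⇒≡ {p} {q} with p ℕ.≟ q
... | yes p≡q = λ _ → p≡q
... | no  _   = λ ()

==-sym : ∀ p q → (p == q) ≡ (q == p)
==-sym p q with p ℕ.≟ q
... | yes p≡q = sym (==-true (sym p≡q))
... | no  p≢q = sym (==-false (p≢q ∘ sym))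

==-suc : ∀ p q → (suc p == suc q) ≡ (p == q)
==-suc p q with p ℕ.≟ q
... | yes p≡q = ==-true (cong suc p≡q)
... | no  p≢q = ==-false (p≢q ∘ ℕP.suc-injective)

[]-false : ∀ {b} x → b ≡ false → [ b ] * x ≡ + 0
[]-false x refl = ℤP.*-zeroˡ x

[∧] : ∀ a b → [ a ∧ b ] ≡ [ a ] * [ b ]
[∧] true  b = sym (ℤP.*-identityˡ [ b ])
[∧] false b = refl

[∨]-disjoint : ∀ a b → (a ≡ true → b ≡ false) → [ a ∨ b ] ≡ [ a ] + [ b ]
[∨]-disjoint true  b a⇒¬b rewrite a⇒¬b refl = refl
[∨]-disjoint false b _    = sym (ℤP.+-identityˡ [ b ])

[]-guard : ∀ {A : Set} (a? : Dec A) E → (¬ A → E ≡ + 0) → [ ⌊ a? ⌋ ] * E ≡ E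
[]-guard (yes _) E _   = ℤP.*-identityˡ E
[]-guard (no ¬a) E ¬a⇒ = trans (ℤP.*-zeroˡ E) (sym (¬a⇒ ¬a))

eqEl-refl : ∀ t u → eqEl t u u ≡ true
eqEl-refl (fin n) a with a F.≟ a
... | yes _   = refl
... | no  a≢a = ⊥-elim (a≢a refl)
eqEl-refl (a ⊞ b) (inj₁ x) = eqEl-refl a x
eqEl-refl (a ⊞ b) (inj₂ y) = eqEl-refl b y
eqEl-refl (sig k g) (i , x) with i F.≟ i
... | yes refl = eqEl-refl (g i) x
... | no  i≢i  = ⊥-elim (i≢i refl)

eqEl⇒≡ : ∀ t {u v} → eqEl t u v ≡ true → u ≡ v
eqEl⇒≡ (fin n) {a} {b} with a F.≟ b
... | yes a≡b = λ _ → a≡b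
... | no  _   = λ ()
eqEl⇒≡ (a ⊞ b) {inj₁ x} {inj₁ y} e = cong inj₁ (eqEl⇒≡ a e)
eqEl⇒≡ (a ⊞ b) {inj₂ x} {inj₂ y} e = cong inj₂ (eqEl⇒≡ b e)
eqEl⇒≡ (sig k g) {i , x} {j , y} with i F.≟ j
... | yes refl = λ e → cong (i ,_) (eqEl⇒≡ (g i) e)
... | no  _    = λ ()

sumFT-δ : ∀ t u (G : El t → ℤ) → sumFT t (λ v → [ eqEl t u v ] * G v) ≡ G u
sumFT-δ t u G = begin
  sumFT t (λ v → [ eqEl t u v ] * G v)  ≡⟨ sumFT-single t _ u off ⟩
  [ eqEl t u u ] * G u                   ≡⟨ cong (λ b → [ b ] * G u) (eqEl-refl t u) ⟩
  + 1 * G u                              ≡⟨ ℤP.*-identityˡ (G u) ⟩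
  G u                                    ∎
  where
  off : ∀ v → v ≢ u → [ eqEl t u v ] * G v ≡ + 0
  off v v≢u with eqEl t u v in e
  ... | true  = ⊥-elim (v≢u (sym (eqEl⇒≡ t e)))
  ... | false = ℤP.*-zeroˡ (G v)

pad : (m : ℕ) → (Fin m → ℤ) → ℕ → ℤ
pad m f j with j ℕ.<? m
... | yes j<m = f (F.fromℕ< j<m)
... | no  _   = + 0

pad-< : ∀ m (f : Fin m → ℤ) {j} (j<m : j < m) → pad m f j ≡ f (F.fromℕ< j<m)
pad-< m f {j} j<m with j ℕ.<? m
... | yes _   = refl
... | no  j≮m = ⊥-elim (j≮m j<m)

pad-≥ : ∀ m (f : Fin m → ℤ) {j} → ¬ j < m → pad m f j ≡ + 0
pad-≥ m f {j} j≮m with j ℕ.<? m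
... | yes j<m = ⊥-elim (j≮m j<m)
... | no  _   = refl

pad-toℕ : ∀ m (f : Fin m → ℤ) i → pad m f (toℕ i) ≡ f i
pad-toℕ m f i = trans (pad-< m f (FP.toℕ<n i)) (cong f (FP.fromℕ<-toℕ i _))

pad-∘toℕ : ∀ m (f : ℕ → ℤ) → (∀ j → ¬ j < m → f j ≡ + 0) → ∀ j → pad m (λ i → f (toℕ i)) j ≡ f j
pad-∘toℕ m f f-beyond j with j ℕ.<? m
... | yes j<m = cong f (FP.toℕ-fromℕ< j<m)
... | no  j≮m = sym (f-beyond j j≮m)

pad-cong : ∀ m {f g : Fin m → ℤ} → (∀ i → f i ≡ g i) → ∀ j → pad m f j ≡ pad m g j
pad-cong m f≗g j with j ℕ.<? m
... | yes _ = f≗g _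
... | no  _ = refl

pad-+ : ∀ m (f g : Fin m → ℤ) j → pad m (λ i → f i + g i) j ≡ pad m f j + pad m g j
pad-+ m f g j with j ℕ.<? m
... | yes _ = refl
... | no  _ = refl

prev : (ℕ → ℤ) → ℕ → ℤ
prev f zero    = + 0
prev f (suc j) = f j

prev-cong : ∀ {f g : ℕ → ℤ} → (∀ j → f j ≡ g j) → ∀ j → prev f j ≡ prev g j
prev-cong f≗g zero    = refl
prev-cong f≗g (suc j) = f≗g j

sumFin-[toℕ==] : ∀ m (F : Fin m → ℤ) c → sumFin m (λ j → [ toℕ j == c ] * F j) ≡ pad m F c
sumFin-[toℕ==] m F c with c ℕ.<? m
... | yes c<m = begin
  sumFin m (λ j → [ toℕ j == c ] * F j)  ≡⟨ sumFin-single m _ i off ⟩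
  [ toℕ i == c ] * F i                   ≡⟨ cong (λ b → [ b ] * F i) (==-true (FP.toℕ-fromℕ< c<m)) ⟩
  + 1 * F i                              ≡⟨ ℤP.*-identityˡ (F i) ⟩
  F i                                    ∎
  where
  i = F.fromℕ< c<m
  off : ∀ j → j ≢ i → [ toℕ j == c ] * F j ≡ + 0
  off j j≢i = []-false (F j) (==-false (λ e → j≢i (FP.toℕ-injective (trans e (sym (FP.toℕ-fromℕ< c<m))))))
... | no c≮m =
  sumFin-zero m _ (λ j → []-false (F j) (==-false (λ e → c≮m (subst (_< m) e (FP.toℕ<n j)))))

sumFin-[1+toℕ==] : ∀ m (F : Fin m → ℤ) c →
  sumFin m (λ j → [ suc (toℕ j) == c ] * F j) ≡ prev (pad m F) c
sumFin-[1+toℕ==] m F zero    = sumFin-zero m _ (λ j → ℤP.*-zeroˡ (F j))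
sumFin-[1+toℕ==] m F (suc c) = trans
  (sumFin-cong m (λ j → cong (λ b → [ b ] * F j) (==-suc (toℕ j) c)))
  (sumFin-[toℕ==] m F c)

parity : ∀ p → Σ ℕ λ h → p ≡ 2 ℕ.* h ⊎ p ≡ suc (2 ℕ.* h)
parity zero = 0 , inj₁ refl
parity (suc p) with parity p
... | h , inj₁ p≡2h   = h , inj₂ (cong suc p≡2h)
... | h , inj₂ p≡1+2h = suc h , inj₁ (trans (cong suc p≡1+2h) (sym (ℕP.*-suc 2 h)))

parity-< : ∀ {p h k} → p ≡ 2 ℕ.* h ⊎ p ≡ suc (2 ℕ.* h) → p < 2 ℕ.* k → h < k
parity-< {h = h} {k} (inj₁ refl) p<2k = ℕP.*-cancelˡ-< 2 h k p<2k
parity-< {h = h} {k} (inj₂ refl) p<2k = ℕP.*-cancelˡ-< 2 h k (ℕP.<-trans (ℕP.n<1+n _) p<2k)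

interleave : (ℕ → ℤ) → (ℕ → ℤ) → ℕ → ℤ
interleave x y zero          = x 0
interleave x y (suc zero)    = y 0
interleave x y (suc (suc p)) = interleave (λ h → x (suc h)) (λ h → y (suc h)) p

interleave-even : ∀ x y h → interleave x y (2 ℕ.* h) ≡ x h
interleave-even x y zero    = refl
interleave-even x y (suc h) = trans
  (cong (interleave x y) (ℕP.*-suc 2 h))
  (interleave-even (λ h → x (suc h)) (λ h → y (suc h)) h)

interleave-odd : ∀ x y h → interleave x y (suc (2 ℕ.* h)) ≡ y h
interleave-odd x y zero    = refl
interleave-odd x y (suc h) = trans
  (cong (interleave x y ∘ suc) (ℕP.*-suc 2 h))
  (interleave-odd (λ h → x (suc h)) (λ h → y (suc h)) h)

interleave-cong : ∀ {x x′ y y′ : ℕ → ℤ} → (∀ h → x h ≡ x′ h) → (∀ h → y h ≡ y′ h) →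
  ∀ p → interleave x y p ≡ interleave x′ y′ p
interleave-cong x≗x′ y≗y′ zero          = x≗x′ 0
interleave-cong x≗x′ y≗y′ (suc zero)    = y≗y′ 0
interleave-cong x≗x′ y≗y′ (suc (suc p)) = interleave-cong (x≗x′ ∘ suc) (y≗y′ ∘ suc) p

interleave-+ : ∀ x y x′ y′ p →
  interleave (λ h → x h + x′ h) (λ h → y h + y′ h) p ≡ interleave x y p + interleave x′ y′ p
interleave-+ x y x′ y′ zero          = refl
interleave-+ x y x′ y′ (suc zero)    = refl
interleave-+ x y x′ y′ (suc (suc p)) =
  interleave-+ (x ∘ suc) (y ∘ suc) (x′ ∘ suc) (y′ ∘ suc) p

interleave-beyond : ∀ k {x y : ℕ → ℤ} → (∀ h → ¬ h < k → x h ≡ + 0) → (∀ h → ¬ h < k → y h ≡ + 0) →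
  ∀ p → ¬ p < 2 ℕ.* k → interleave x y p ≡ + 0
interleave-beyond k {x} {y} x-beyond y-beyond p p≮2k with parity p
... | h , inj₁ refl = trans (interleave-even x y h) (x-beyond h (p≮2k ∘ ℕP.*-monoʳ-< 2))
... | h , inj₂ refl = trans (interleave-odd x y h) (y-beyond h (p≮2k ∘ odd<))
  where
  odd< : h < k → suc (2 ℕ.* h) < 2 ℕ.* k
  odd< h<k = subst (_≤ 2 ℕ.* k) (ℕP.*-suc 2 h) (ℕP.*-monoʳ-≤ 2 h<k)

at-index : ∀ {k} (P : ℕ → Set) → (∀ (i : Fin k) → P (toℕ i)) → ∀ {h} → h < k → P h
at-index P P-toℕ h<k = subst P (FP.toℕ-fromℕ< h<k) (P-toℕ (F.fromℕ< h<k))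

interleave-≡ : ∀ k {x y f : ℕ → ℤ} →
  (∀ (i : Fin k) → x (toℕ i) ≡ f (2 ℕ.* toℕ i)) → (∀ (i : Fin k) → y (toℕ i) ≡ f (suc (2 ℕ.* toℕ i))) →
  ∀ p → p < 2 ℕ.* k → interleave x y p ≡ f p
interleave-≡ k {x} {y} {f} x≡ y≡ p p<2k with parity p
... | h , inj₁ refl = trans (interleave-even x y h) (at-index (λ h → x h ≡ f (2 ℕ.* h)) x≡ h<k)
  where h<k = parity-< (inj₁ refl) p<2k
... | h , inj₂ refl = trans (interleave-odd x y h) (at-index (λ h → y h ≡ f (suc (2 ℕ.* h))) y≡ h<k)
  where h<k = parity-< (inj₂ refl) p<2k

-- Coordinates on one part (junk values for parts of size < 2)

xCoord : (m : ℕ) → (Fin m → ℤ) → ℤ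
xCoord (suc (suc _)) v = v (F.suc F.zero)
xCoord _             _ = + 0

yCoord : (m : ℕ) → (Fin m → ℤ) → ℤ
yCoord (suc (suc r)) v = v F.zero - + suc r * v (F.suc F.zero) + sumFin r (λ j → v (F.suc (F.suc j)))
yCoord _             _ = + 0

dCoord : (m : ℕ) → (Fin m → ℤ) → Fin (m ℕ.∸ 2) → ℤ
dCoord (suc (suc r)) v j = v (F.suc (F.suc j)) - v (F.suc F.zero)

fromCoords : (m : ℕ) → (Fin (m ℕ.∸ 2) → ℤ) → ℤ → ℤ → Fin m → ℤ
fromCoords (suc (suc r)) d x y F.zero            = y + x - sumFin r d
fromCoords (suc (suc r)) d x y (F.suc F.zero)    = x
fromCoords (suc (suc r)) d x y (F.suc (F.suc j)) = x + d j
fromCoords (suc zero)    d x y F.zero            = + 0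

xCoord-cong : ∀ m {u v : Fin m → ℤ} → (∀ a → u a ≡ v a) → xCoord m u ≡ xCoord m v
xCoord-cong zero          _   = refl
xCoord-cong (suc zero)    _   = refl
xCoord-cong (suc (suc r)) u≗v = u≗v (F.suc F.zero)

yCoord-cong : ∀ m {u v : Fin m → ℤ} → (∀ a → u a ≡ v a) → yCoord m u ≡ yCoord m v
yCoord-cong zero          _   = refl
yCoord-cong (suc zero)    _   = refl
yCoord-cong (suc (suc r)) u≗v = cong₂ _+_
  (cong₂ _-_ (u≗v F.zero) (cong (+ suc r *_) (u≗v (F.suc F.zero))))
  (sumFin-cong r (λ j → u≗v (F.suc (F.suc j))))

dCoord-cong : ∀ m {u v : Fin m → ℤ} → (∀ a → u a ≡ v a) → ∀ j → dCoord m u j ≡ dCoord m v j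
dCoord-cong (suc (suc r)) u≗v j = cong₂ _-_ (u≗v (F.suc (F.suc j))) (u≗v (F.suc F.zero))

fromCoords-cong : ∀ m {d d′ : Fin (m ℕ.∸ 2) → ℤ} {x x′ y y′} →
  (∀ j → d j ≡ d′ j) → x ≡ x′ → y ≡ y′ → ∀ a → fromCoords m d x y a ≡ fromCoords m d′ x′ y′ a
fromCoords-cong (suc (suc r)) {x = x} {y = y} d≗d′ refl refl F.zero =
  cong (λ t → y + x - t) (sumFin-cong r d≗d′)
fromCoords-cong (suc (suc r))         d≗d′ refl refl (F.suc F.zero)    = refl
fromCoords-cong (suc (suc r)) {x = x} d≗d′ refl refl (F.suc (F.suc j)) = cong (_+_ x) (d≗d′ j)
fromCoords-cong (suc zero)            d≗d′ refl refl F.zero            = refl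

xCoord-+ : ∀ m u v → xCoord m (λ a → u a + v a) ≡ xCoord m u + xCoord m v
xCoord-+ zero          u v = refl
xCoord-+ (suc zero)    u v = refl
xCoord-+ (suc (suc r)) u v = refl

yCoord-+ : ∀ m u v → yCoord m (λ a → u a + v a) ≡ yCoord m u + yCoord m v
yCoord-+ zero          u v = refl
yCoord-+ (suc zero)    u v = refl
yCoord-+ (suc (suc r)) u v = trans
  (cong (_+_ (u F.zero + v F.zero - + suc r * (u (F.suc F.zero) + v (F.suc F.zero))))
        (sumFin-+ r (λ j → u (F.suc (F.suc j))) (λ j → v (F.suc (F.suc j)))))
  (regroup (u F.zero) (v F.zero) (+ suc r) (u (F.suc F.zero)) (v (F.suc F.zero)) _ _)
  where
  regroup : ∀ a b c d e f g → a + b - c * (d + e) + (f + g) ≡ a - c * d + f + (b - c * e + g)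
  regroup = solve-∀

dCoord-+ : ∀ m u v j → dCoord m (λ a → u a + v a) j ≡ dCoord m u j + dCoord m v j
dCoord-+ (suc (suc r)) u v j =
  regroup (u (F.suc (F.suc j))) (v (F.suc (F.suc j))) (u (F.suc F.zero)) (v (F.suc F.zero))
  where
  regroup : ∀ a b c d → a + b - (c + d) ≡ a - c + (b - d)
  regroup = solve-∀

xCoord-fromCoords : ∀ m → 2 ≤ m → ∀ d x y → xCoord m (fromCoords m d x y) ≡ x
xCoord-fromCoords (suc (suc r)) (s≤s (s≤s z≤n)) d x y = refl

yCoord-fromCoords : ∀ m → 2 ≤ m → ∀ d x y → yCoord m (fromCoords m d x y) ≡ y
yCoord-fromCoords (suc (suc r)) (s≤s (s≤s z≤n)) d x y = begin
  y + x - sumFin r d - + suc r * x + sumFin r (λ j → x + d j)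
    ≡⟨ cong (_+_ (y + x - sumFin r d - + suc r * x))
         (trans (sumFin-+ r (λ _ → x) d) (cong (_+ sumFin r d) (sumFin-const r x))) ⟩
  y + x - sumFin r d - + suc r * x + (+ r * x + sumFin r d)
    ≡⟨ cong (λ t → y + x - sumFin r d - t * x + (+ r * x + sumFin r d)) (ℤP.pos-+ 1 r) ⟩
  y + x - sumFin r d - (+ 1 + + r) * x + (+ r * x + sumFin r d)
    ≡⟨ cancel y x (sumFin r d) (+ r) ⟩
  y ∎
  where
  cancel : ∀ y x s r → y + x - s - (+ 1 + r) * x + (r * x + s) ≡ y
  cancel = solve-∀

dCoord-fromCoords : ∀ m d x y j → dCoord m (fromCoords m d x y) j ≡ d j
dCoord-fromCoords (suc (suc r)) d x y j = cancel x (d j)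
  where
  cancel : ∀ a b → a + b - a ≡ b
  cancel = solve-∀

fromCoords-coords : ∀ m → 2 ≤ m → ∀ v a → fromCoords m (dCoord m v) (xCoord m v) (yCoord m v) a ≡ v a
fromCoords-coords (suc (suc r)) (s≤s (s≤s z≤n)) v F.zero = begin
  yCoord (suc (suc r)) v + v₁ - sumFin r (λ j → v (F.suc (F.suc j)) - v₁)
    ≡⟨ cong (_-_ (yCoord (suc (suc r)) v + v₁))
         (trans (sumFin-sub r _ (λ _ → v₁)) (cong (_-_ Σv) (sumFin-const r v₁))) ⟩
  v₀ - + suc r * v₁ + Σv + v₁ - (Σv - + r * v₁)
    ≡⟨ cong (λ t → v₀ - t * v₁ + Σv + v₁ - (Σv - + r * v₁)) (ℤP.pos-+ 1 r) ⟩
  v₀ - (+ 1 + + r) * v₁ + Σv + v₁ - (Σv - + r * v₁)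
    ≡⟨ cancel v₀ v₁ Σv (+ r) ⟩
  v₀ ∎
  where
  v₀ = v F.zero
  v₁ = v (F.suc F.zero)
  Σv = sumFin r (λ j → v (F.suc (F.suc j)))
  cancel : ∀ v₀ v₁ s r → v₀ - (+ 1 + r) * v₁ + s + v₁ - (s - r * v₁) ≡ v₀
  cancel = solve-∀
fromCoords-coords (suc (suc r)) (s≤s (s≤s z≤n)) v (F.suc F.zero)    = refl
fromCoords-coords (suc (suc r)) (s≤s (s≤s z≤n)) v (F.suc (F.suc j)) = cancel (v (F.suc F.zero)) (v (F.suc (F.suc j)))
  where
  cancel : ∀ a b → a + (b - a) ≡ b
  cancel = solve-∀

xCoord-affine : ∀ m → 2 ≤ m → ∀ D W v → xCoord m (λ a → D * v a - W) ≡ D * xCoord m v - W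
xCoord-affine (suc (suc r)) (s≤s (s≤s z≤n)) D W v = refl

dCoord-affine : ∀ m D W v j → dCoord m (λ a → D * v a - W) j ≡ D * dCoord m v j
dCoord-affine (suc (suc r)) D W v j = cancel D (v (F.suc (F.suc j))) (v (F.suc F.zero)) W
  where
  cancel : ∀ D a b W → D * a - W - (D * b - W) ≡ D * (a - b)
  cancel = solve-∀

-- The weights 1, −(m−1), 1, …, 1 of y sum to zero, so y does not see the constant W.
yCoord-affine : ∀ m D W v → yCoord m (λ a → D * v a - W) ≡ D * yCoord m v
yCoord-affine zero          D W v = sym (ℤP.*-zeroʳ D)
yCoord-affine (suc zero)    D W v = sym (ℤP.*-zeroʳ D)
yCoord-affine (suc (suc r)) D W v = begin
  D * v₀ - W - + suc r * (D * v₁ - W) + sumFin r (λ j → D * v (F.suc (F.suc j)) - W)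
    ≡⟨ cong (_+_ (D * v₀ - W - + suc r * (D * v₁ - W)))
         (trans (sumFin-sub r _ (λ _ → W)) (cong₂ _-_ (sumFin-*ˡ r D _) (sumFin-const r W))) ⟩
  D * v₀ - W - + suc r * (D * v₁ - W) + (D * Σv - + r * W)
    ≡⟨ cong (λ t → D * v₀ - W - t * (D * v₁ - W) + (D * Σv - + r * W)) (ℤP.pos-+ 1 r) ⟩
  D * v₀ - W - (+ 1 + + r) * (D * v₁ - W) + (D * Σv - + r * W)
    ≡⟨ factor D v₀ v₁ W Σv (+ r) ⟩
  D * (v₀ - (+ 1 + + r) * v₁ + Σv)
    ≡⟨ cong (λ t → D * (v₀ - t * v₁ + Σv)) (sym (ℤP.pos-+ 1 r)) ⟩
  D * yCoord (suc (suc r)) v ∎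
  where
  v₀ = v F.zero
  v₁ = v (F.suc F.zero)
  Σv = sumFin r (λ j → v (F.suc (F.suc j)))
  factor : ∀ D v₀ v₁ W s r →
    D * v₀ - W - (+ 1 + r) * (D * v₁ - W) + (D * s - r * W) ≡ D * (v₀ - (+ 1 + r) * v₁ + s)
  factor = solve-∀

sumFin-coords : ∀ m → 2 ≤ m → ∀ v → + m * xCoord m v + yCoord m v ≡ sumFin m v
sumFin-coords (suc (suc r)) (s≤s (s≤s z≤n)) v = begin
  + suc (suc r) * v₁ + (v₀ - + suc r * v₁ + Σv)
    ≡⟨ cong₂ (λ a b → a * v₁ + (v₀ - b * v₁ + Σv)) (ℤP.pos-+ 2 r) (ℤP.pos-+ 1 r) ⟩
  (+ 2 + + r) * v₁ + (v₀ - (+ 1 + + r) * v₁ + Σv)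
    ≡⟨ regroup v₀ v₁ Σv (+ r) ⟩
  v₀ + (v₁ + Σv) ∎
  where
  v₀ = v F.zero
  v₁ = v (F.suc F.zero)
  Σv = sumFin r (λ j → v (F.suc (F.suc j)))
  regroup : ∀ v₀ v₁ s r → (+ 2 + r) * v₁ + (v₀ - (+ 1 + r) * v₁ + s) ≡ v₀ + (v₁ + s)
  regroup = solve-∀

-- Cokernels

image : (P : Pres) → (El (rel P) → ℤ) → Vec P
image P z g = sumFT (rel P) (λ r → mat P g r * z r)

image-zero : ∀ P g → image P (λ _ → + 0) g ≡ + 0
image-zero P g = sumFT-zero (rel P) _ (λ r → ℤP.*-zeroʳ (mat P g r))

≗⇒∼ : ∀ P {x y : Vec P} → (∀ g → x g ≡ y g) → x ∼⟨ P ⟩ y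
≗⇒∼ P {x} {y} x≗y = (λ _ → + 0) , λ g → begin
  x g - y g              ≡⟨ cong (_- y g) (x≗y g) ⟩
  y g - y g              ≡⟨ ℤP.+-inverseʳ (y g) ⟩
  + 0                    ≡⟨ sym (image-zero P g) ⟩
  image P (λ _ → + 0) g  ∎

image-⊕₁ : ∀ P Q w g → image (P ⊕ Q) w (inj₁ g) ≡ image P (λ r → w (inj₁ r)) g
image-⊕₁ P Q w g = trans
  (cong (_+_ (image P (λ r → w (inj₁ r)) g)) (sumFT-zero (rel Q) _ (λ r → ℤP.*-zeroˡ (w (inj₂ r)))))
  (ℤP.+-identityʳ _)

image-⊕₂ : ∀ P Q w g → image (P ⊕ Q) w (inj₂ g) ≡ image Q (λ r → w (inj₂ r)) g
image-⊕₂ P Q w g = trans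
  (cong (_+ image Q (λ r → w (inj₂ r)) g) (sumFT-zero (rel P) _ (λ r → ℤP.*-zeroˡ (w (inj₁ r)))))
  (ℤP.+-identityˡ _)

image-⨁ : ∀ m (Ps : Fin m → Pres) i a w → image (⨁ m Ps) w (i , a) ≡ image (Ps i) (λ b → w (i , b)) a
image-⨁ m Ps i a w = trans
  (sumFin-single m _ i (λ j j≢i → sumFT-zero (rel (Ps j)) _ (off j j≢i)))
  (sumFT-cong (rel (Ps i)) (λ b → cong (_* w (i , b)) (diagonal b)))
  where
  diagonal : ∀ b → mat (⨁ m Ps) (i , a) (i , b) ≡ mat (Ps i) a b
  diagonal b with i F.≟ i
  ... | yes refl = refl
  ... | no  i≢i  = ⊥-elim (i≢i refl)
  off : ∀ j → j ≢ i → ∀ b → mat (⨁ m Ps) (i , a) (j , b) * w (j , b) ≡ + 0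
  off j j≢i b with i F.≟ j
  ... | yes i≡j = ⊥-elim (j≢i (sym i≡j))
  ... | no  _   = ℤP.*-zeroˡ (w (j , b))

image-ZMod : ∀ N w g → image (ZMod N) w g ≡ + N * w F.zero
image-ZMod N w g = ℤP.+-identityʳ _

additive⇒subtractive : ∀ {A B : Set} (f : (A → ℤ) → B → ℤ) →
  (∀ {x y} → (∀ a → x a ≡ y a) → ∀ b → f x b ≡ f y b) →
  (∀ x y b → f (λ a → x a + y a) b ≡ f x b + f y b) →
  ∀ x y b → f (λ a → x a - y a) b ≡ f x b - f y b
additive⇒subtractive f f-ext f-+ x y b = begin
  f d b                           ≡⟨ sym (add-sub (f d b) (f y b)) ⟩
  f d b + f y b - f y b           ≡⟨ cong (_- f y b) (sym (f-+ d y b)) ⟩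
  f (λ a → d a + y a) b - f y b   ≡⟨ cong (_- f y b) (f-ext (λ a → sub-add (x a) (y a)) b) ⟩
  f x b - f y b                   ∎
  where
  d = λ a → x a - y a
  add-sub : ∀ a b → a + b - b ≡ a
  add-sub = solve-∀
  sub-add : ∀ a b → a - b + b ≡ a
  sub-add = solve-∀

record BasisChange (P Q : Pres) : Set where
  field
    to             : Vec P → Vec Q
    from           : Vec Q → Vec P
    toRel          : (El (rel P) → ℤ) → El (rel Q) → ℤ
    fromRel        : (El (rel Q) → ℤ) → El (rel P) → ℤ
    to-ext         : ∀ {x y} → (∀ g → x g ≡ y g) → ∀ g → to x g ≡ to y g
    from-ext       : ∀ {x y} → (∀ g → x g ≡ y g) → ∀ g → from x g ≡ from y g
    to-+           : ∀ x y g → to (λ h → x h + y h) g ≡ to x g + to y g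
    from∘to        : ∀ x g → from (to x) g ≡ x g
    to∘from        : ∀ y g → to (from y) g ≡ y g
    toRel∘fromRel  : ∀ z r → toRel (fromRel z) r ≡ z r
    to-image       : ∀ z g → to (image P z) g ≡ image Q (toRel z) g

module _ {P Q : Pres} (B : BasisChange P Q) where
  open BasisChange B

  from-+ : ∀ x y g → from (λ h → x h + y h) g ≡ from x g + from y g
  from-+ x y g = begin
    from (λ h → x h + y h) g
      ≡⟨ from-ext (λ h → cong₂ _+_ (sym (to∘from x h)) (sym (to∘from y h))) g ⟩
    from (λ h → to (from x) h + to (from y) h) g
      ≡⟨ from-ext (λ h → sym (to-+ (from x) (from y) h)) g ⟩
    from (to (λ h → from x h + from y h)) g
      ≡⟨ from∘to _ g ⟩
    from x g + from y g ∎

  basisChange⇒≅ : P ≅ Q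
  basisChange⇒≅ = record
    { to        = to
    ; from      = from
    ; to-cong   = λ x y (z , x-y≡Lz) → toRel z , λ g → begin
        to x g - to y g          ≡⟨ sym (additive⇒subtractive to to-ext to-+ x y g) ⟩
        to (λ h → x h - y h) g   ≡⟨ to-ext x-y≡Lz g ⟩
        to (image P z) g         ≡⟨ to-image z g ⟩
        image Q (toRel z) g      ∎
    ; from-cong = λ x y (z , x-y≡Lz) → fromRel z , λ g → begin
        from x g - from y g                   ≡⟨ sym (additive⇒subtractive from from-ext from-+ x y g) ⟩
        from (λ h → x h - y h) g              ≡⟨ from-ext x-y≡Lz g ⟩
        from (image Q z) g
          ≡⟨ from-ext (λ h → sumFT-cong (rel Q) (λ r → cong (mat Q h r *_) (sym (toRel∘fromRel z r)))) g ⟩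
        from (image Q (toRel (fromRel z))) g  ≡⟨ from-ext (λ h → sym (to-image (fromRel z) h)) g ⟩
        from (to (image P (fromRel z))) g     ≡⟨ from∘to _ g ⟩
        image P (fromRel z) g                 ∎
    ; to-hom    = λ x y → ≗⇒∼ Q (to-+ x y)
    ; from-hom  = λ x y → ≗⇒∼ P (from-+ x y)
    ; from-to   = λ x → ≗⇒∼ P (from∘to x)
    ; to-from   = λ y → ≗⇒∼ Q (to∘from y)
    }

laplacian-entry : ∀ V (adj : El V → El V → Bool) → (∀ u → adj u u ≡ false) → ∀ u v x →
  laplacian V adj u v * x ≡ [ eqEl V u v ] * (degree V adj u * x) - [ adj u v ] * x
laplacian-entry V adj irrefl u v x with eqEl V u v in e
... | true rewrite eqEl⇒≡ V e | irrefl v = diagonal (degree V adj v) x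
  where
  diagonal : ∀ d x → d * x ≡ + 1 * (d * x) - + 0 * x
  diagonal = solve-∀
... | false with adj u v
...   | true  = adjacent x
  where
  adjacent : ∀ x → - (+ 1) * x ≡ + 0 * x - + 1 * x
  adjacent = solve-∀
...   | false = ℤP.*-zeroˡ x

image-lapPres : ∀ V (adj : El V → El V → Bool) → (∀ u → adj u u ≡ false) → ∀ z u →
  image (lapPres V adj) z u ≡ degree V adj u * z u - sumFT V (λ v → [ adj u v ] * z v)
image-lapPres V adj irrefl z u = begin
  sumFT V (λ v → laplacian V adj u v * z v)
    ≡⟨ sumFT-cong V (λ v → laplacian-entry V adj irrefl u v (z v)) ⟩
  sumFT V (λ v → [ eqEl V u v ] * (degree V adj u * z v) - [ adj u v ] * z v)
    ≡⟨ sumFT-sub V _ _ ⟩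
  sumFT V (λ v → [ eqEl V u v ] * (degree V adj u * z v)) - sumFT V (λ v → [ adj u v ] * z v)
    ≡⟨ cong (_- sumFT V (λ v → [ adj u v ] * z v)) (sumFT-δ V u (λ v → degree V adj u * z v)) ⟩
  degree V adj u * z u - sumFT V (λ v → [ adj u v ] * z v) ∎

-- The nonzero entries of L₃ listed in the statement for one index i: in rows 2i−1 (odd) and 2i
-- (even), with the off-diagonal pairs present only when i ≤ k−1 (right) and 2 ≤ i (left).
-- L3entry k n p q unfolds to the sum over i of stencilEntry (stencilAt i) p q below.
record Stencil : Set where
  field
    odd even right₁ right₂ left₁ left₂ : ℕ
    diag nRight nLeft                  : ℤ
    hasRight hasLeft                   : Bool

entry : Bool → ℕ → ℤ → ℕ → ℤ
entry a β v q = [ a ∧ (q == β) ] * v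

stencilEntry : Stencil → ℕ → ℕ → ℤ
stencilEntry s p q =
    entry (p == odd) odd diag q
  + entry (p == even) even diag q
  + [ hasRight ] * (entry (p == odd) right₁ (- nRight) q + entry (p == odd) right₂ (- (+ 1)) q)
  + [ hasLeft ] * (entry (p == odd) left₁ (- nLeft) q + entry (p == odd) left₂ (- (+ 1)) q)
  where open Stencil s

stencilValue : (ℕ → ℤ) → Stencil → ℕ → ℤ
stencilValue w s p =
    [ p == odd ] * diag * w odd
  + [ p == even ] * diag * w even
  + [ hasRight ] * ([ p == odd ] * - nRight * w right₁ + [ p == odd ] * - (+ 1) * w right₂)
  + [ hasLeft ] * ([ p == odd ] * - nLeft * w left₁ + [ p == odd ] * - (+ 1) * w left₂)
  where open Stencil s

module _ (m : ℕ) (c : ℕ → ℤ) (c-beyond : ∀ j → ¬ j < m → c j ≡ + 0) where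

  private
    colSum : (ℕ → ℤ) → ℤ
    colSum f = sumFin m (λ q → f (suc (toℕ q)) * c (toℕ q))

    colSum-+ : ∀ f g → colSum (λ q → f q + g q) ≡ colSum f + colSum g
    colSum-+ f g = trans (sumFin-cong m (λ q → ℤP.*-distribʳ-+ (c (toℕ q)) (f _) (g _))) (sumFin-+ m _ _)

    colSum-* : ∀ a f → colSum (λ q → a * f q) ≡ a * colSum f
    colSum-* a f = trans (sumFin-cong m (λ q → ℤP.*-assoc a (f _) (c (toℕ q)))) (sumFin-*ˡ m a _)

    colSum-entry : ∀ a β v → colSum (entry a β v) ≡ [ a ] * v * prev c β
    colSum-entry a β v = begin
      sumFin m (λ q → [ a ∧ (suc (toℕ q) == β) ] * v * c (toℕ q))
        ≡⟨ sumFin-cong m (λ q → trans (cong (λ t → t * v * c (toℕ q)) ([∧] a _)) (reassoc [ a ] _ v _)) ⟩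
      sumFin m (λ q → [ a ] * v * ([ suc (toℕ q) == β ] * c (toℕ q)))
        ≡⟨ sumFin-*ˡ m ([ a ] * v) _ ⟩
      [ a ] * v * sumFin m (λ q → [ suc (toℕ q) == β ] * c (toℕ q))
        ≡⟨ cong (_*_ ([ a ] * v)) (sumFin-[1+toℕ==] m (c ∘ toℕ) β) ⟩
      [ a ] * v * prev (pad m (c ∘ toℕ)) β
        ≡⟨ cong (_*_ ([ a ] * v)) (prev-cong (pad-∘toℕ m c c-beyond) β) ⟩
      [ a ] * v * prev c β ∎
      where
      reassoc : ∀ A B v c → A * B * v * c ≡ A * v * (B * c)
      reassoc = solve-∀

    colSum-pair : ∀ g f f′ → colSum (λ q → [ g ] * (f q + f′ q)) ≡ [ g ] * (colSum f + colSum f′)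
    colSum-pair g f f′ = trans (colSum-* [ g ] (λ q → f q + f′ q)) (cong (_*_ [ g ]) (colSum-+ f f′))

  stencil-sum : ∀ s p → sumFin m (λ q → stencilEntry s p (suc (toℕ q)) * c (toℕ q)) ≡ stencilValue (prev c) s p
  stencil-sum s p = begin
    colSum (stencilEntry s p)
      ≡⟨ colSum-+ (λ q → E₁ q + E₂ q + [ hasRight ] * (E₃ q + E₄ q)) (λ q → [ hasLeft ] * (E₅ q + E₆ q)) ⟩
    colSum (λ q → E₁ q + E₂ q + [ hasRight ] * (E₃ q + E₄ q)) + colSum (λ q → [ hasLeft ] * (E₅ q + E₆ q))
      ≡⟨ cong₂ _+_ (colSum-+ (λ q → E₁ q + E₂ q) (λ q → [ hasRight ] * (E₃ q + E₄ q))) (colSum-pair hasLeft E₅ E₆) ⟩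
    colSum (λ q → E₁ q + E₂ q) + colSum (λ q → [ hasRight ] * (E₃ q + E₄ q)) + [ hasLeft ] * (colSum E₅ + colSum E₆)
      ≡⟨ cong (_+ [ hasLeft ] * (colSum E₅ + colSum E₆)) (cong₂ _+_ (colSum-+ E₁ E₂) (colSum-pair hasRight E₃ E₄)) ⟩
    colSum E₁ + colSum E₂ + [ hasRight ] * (colSum E₃ + colSum E₄) + [ hasLeft ] * (colSum E₅ + colSum E₆)
      ≡⟨ cong₂ _+_ (cong₂ _+_ (cong₂ _+_ (colSum-entry (p == odd) odd diag) (colSum-entry (p == even) even diag))
                             (cong (_*_ [ hasRight ]) (cong₂ _+_ (colSum-entry (p == odd) right₁ (- nRight))
                                                                 (colSum-entry (p == odd) right₂ (- (+ 1))))))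
                  (cong (_*_ [ hasLeft ]) (cong₂ _+_ (colSum-entry (p == odd) left₁ (- nLeft))
                                                     (colSum-entry (p == odd) left₂ (- (+ 1))))) ⟩
    stencilValue (prev c) s p ∎
    where
    open Stencil s
    E₁ = entry (p == odd) odd diag
    E₂ = entry (p == even) even diag
    E₃ = entry (p == odd) right₁ (- nRight)
    E₄ = entry (p == odd) right₂ (- (+ 1))
    E₅ = entry (p == odd) left₁ (- nLeft)
    E₆ = entry (p == odd) left₂ (- (+ 1))

module _ (w : ℕ → ℤ) (s : Stencil) (p : ℕ) where
  open Stencil s

  stencilValue-off : (p == odd) ≡ false → (p == even) ≡ false → stencilValue w s p ≡ + 0
  stencilValue-off o e rewrite o | e =
    vanish diag (w odd) (w even) [ hasRight ] nRight (w right₁) (w right₂) [ hasLeft ] nLeft (w left₁) (w left₂)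
    where
    vanish : ∀ N a b g nr c d h nl e f →
      + 0 * N * a + + 0 * N * b + g * (+ 0 * - nr * c + + 0 * - (+ 1) * d)
        + h * (+ 0 * - nl * e + + 0 * - (+ 1) * f) ≡ + 0
    vanish = solve-∀

  stencilValue-odd : (p == odd) ≡ true → (p == even) ≡ false →
    stencilValue w s p ≡ diag * w odd - [ hasRight ] * (nRight * w right₁ + w right₂)
                                       - [ hasLeft ] * (nLeft * w left₁ + w left₂)
  stencilValue-odd o e rewrite o | e =
    regroup diag (w odd) (w even) [ hasRight ] nRight (w right₁) (w right₂) [ hasLeft ] nLeft (w left₁) (w left₂)
    where
    regroup : ∀ N a b g nr c d h nl e f →
      + 1 * N * a + + 0 * N * b + g * (+ 1 * - nr * c + + 1 * - (+ 1) * d)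
        + h * (+ 1 * - nl * e + + 1 * - (+ 1) * f) ≡ N * a - g * (nr * c + d) - h * (nl * e + f)
    regroup = solve-∀

  stencilValue-even : (p == odd) ≡ false → (p == even) ≡ true → stencilValue w s p ≡ diag * w even
  stencilValue-even o e rewrite o | e =
    regroup diag (w odd) (w even) [ hasRight ] nRight (w right₁) (w right₂) [ hasLeft ] nLeft (w left₁) (w left₂)
    where
    regroup : ∀ N a b g nr c d h nl e f →
      + 0 * N * a + + 1 * N * b + g * (+ 0 * - nr * c + + 0 * - (+ 1) * d)
        + h * (+ 0 * - nl * e + + 0 * - (+ 1) * f) ≡ N * b
    regroup = solve-∀

odd-position : ∀ h → 2 ℕ.* suc h ℕ.∸ 1 ≡ suc (2 ℕ.* h)
odd-position h = cong (λ t → t ℕ.∸ 1) (ℕP.*-suc 2 h)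

even-position : ∀ h → 2 ℕ.* suc h ≡ suc (suc (2 ℕ.* h))
even-position h = ℕP.*-suc 2 h

-- The graph G_{n₁,…,n_k}

module Layered (k : ℕ) (n : Fin k → ℕ) where

  V : FT
  V = Gverts k n

  Lap : Pres
  Lap = lapPres V (Gadj k n)

  N : Fin k → ℕ
  N i = NN k n (suc (toℕ i))

  Blocks : Fin k → Pres
  Blocks i = ZMod (N i) ^⊕ (n i ℕ.∸ 2)

  Target : Pres
  Target = ⨁ k Blocks ⊕ cokerMat (2 ℕ.* k) (L3 k n)

  adjacent : Fin k → Fin k → Bool
  adjacent i j = (suc (toℕ i) == toℕ j) ∨ (suc (toℕ j) == toℕ i)

  adjacent-irrefl : ∀ i → adjacent i i ≡ false
  adjacent-irrefl i rewrite ==-false {suc (toℕ i)} {toℕ i} ℕP.1+n≢n = refl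

  adjacent-sum : ∀ i (F : Fin k → ℤ) →
    sumFin k (λ j → [ adjacent i j ] * F j) ≡ pad k F (suc (toℕ i)) + prev (pad k F) (toℕ i)
  adjacent-sum i F = begin
    sumFin k (λ j → [ adjacent i j ] * F j)
      ≡⟨ sumFin-cong k (λ j → trans (cong (_* F j) ([∨]-disjoint _ _ (not-both (toℕ i) (toℕ j))))
                                    (ℤP.*-distribʳ-+ (F j) [ suc (toℕ i) == toℕ j ] [ suc (toℕ j) == toℕ i ])) ⟩
    sumFin k (λ j → [ suc (toℕ i) == toℕ j ] * F j + [ suc (toℕ j) == toℕ i ] * F j)
      ≡⟨ sumFin-+ k _ _ ⟩
    sumFin k (λ j → [ suc (toℕ i) == toℕ j ] * F j) + sumFin k (λ j → [ suc (toℕ j) == toℕ i ] * F j)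
      ≡⟨ cong₂ _+_ (trans (sumFin-cong k (λ j → cong (λ b → [ b ] * F j) (==-sym (suc (toℕ i)) (toℕ j)))) (sumFin-[toℕ==] k F (suc (toℕ i))))
                   (sumFin-[1+toℕ==] k F (toℕ i)) ⟩
    pad k F (suc (toℕ i)) + prev (pad k F) (toℕ i) ∎
    where
    not-both : ∀ a b → (suc a == b) ≡ true → (suc b == a) ≡ false
    not-both a b e = ==-false (λ 1+b≡a →
      ℕP.<-irrefl (trans (sym 1+b≡a) (cong suc (sym (==⇒≡ e)))) (ℕP.m<n⇒m<1+n (ℕP.n<1+n a)))

  nAt-beyond : ∀ j → ¬ j < k → nAt k n (suc j) ≡ 0
  nAt-beyond j j≮k with j ℕ.<? k
  ... | yes j<k = ⊥-elim (j≮k j<k)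
  ... | no  _   = refl

  +nAt≡ : ∀ j → + nAt k n j ≡ prev (pad k (λ i → + n i)) j
  +nAt≡ zero    = refl
  +nAt≡ (suc j) with j ℕ.<? k
  ... | yes _ = refl
  ... | no  _ = refl

  NN≡ : ∀ h → NN k n (suc h) ≡ nAt k n h ℕ.+ nAt k n (suc (suc h))
  NN≡ zero    = refl
  NN≡ (suc h) with suc (suc h) ℕ.≟ k
  ... | yes 2+h≡k = begin
    nAt k n (k ℕ.∸ 1)                                 ≡⟨ cong (λ t → nAt k n (t ℕ.∸ 1)) (sym 2+h≡k) ⟩
    nAt k n (suc h)                                   ≡⟨ sym (ℕP.+-identityʳ _) ⟩
    nAt k n (suc h) ℕ.+ 0
      ≡⟨ cong (nAt k n (suc h) ℕ.+_) (sym (nAt-beyond (suc (suc h)) (ℕP.<-irrefl 2+h≡k))) ⟩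
    nAt k n (suc h) ℕ.+ nAt k n (suc (suc (suc h)))   ∎
  ... | no  _ = cong (λ t → nAt k n (suc h) ℕ.+ nAt k n t) (ℕP.+-comm (suc (suc h)) 1)

  degree≡N : ∀ i a → degree V (Gadj k n) (i , a) ≡ + N i
  degree≡N i a = begin
    sumFin k (λ j → sumFin (n j) (λ _ → [ adjacent i j ]))
      ≡⟨ sumFin-cong k (λ j → trans (sumFin-const (n j) _) (ℤP.*-comm (+ n j) _)) ⟩
    sumFin k (λ j → [ adjacent i j ] * + n j)
      ≡⟨ adjacent-sum i (λ j → + n j) ⟩
    pad k (λ j → + n j) (suc h) + prev (pad k (λ j → + n j)) h
      ≡⟨ cong₂ _+_ (sym (+nAt≡ (suc (suc h)))) (sym (+nAt≡ h)) ⟩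
    + nAt k n (suc (suc h)) + + nAt k n h
      ≡⟨ ℤP.+-comm (+ nAt k n (suc (suc h))) (+ nAt k n h) ⟩
    + nAt k n h + + nAt k n (suc (suc h))
      ≡⟨ sym (ℤP.pos-+ (nAt k n h) _) ⟩
    + (nAt k n h ℕ.+ nAt k n (suc (suc h)))
      ≡⟨ cong +_ (sym (NN≡ h)) ⟩
    + N i ∎
    where h = toℕ i

  partSum : (El V → ℤ) → Fin k → ℤ
  partSum z j = sumFin (n j) (λ b → z (j , b))

  neighbourSum : Fin k → (El V → ℤ) → ℤ
  neighbourSum i z = sumFin k (λ j → [ adjacent i j ] * partSum z j)

  image-Lap : ∀ z i a → image Lap z (i , a) ≡ + N i * z (i , a) - neighbourSum i z
  image-Lap z i a = begin
    image Lap z (i , a)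
      ≡⟨ image-lapPres V (Gadj k n) (λ (j , _) → adjacent-irrefl j) z (i , a) ⟩
    degree V (Gadj k n) (i , a) * z (i , a) - sumFT V (λ v → [ Gadj k n (i , a) v ] * z v)
      ≡⟨ cong₂ _-_ (cong (_* z (i , a)) (degree≡N i a))
                   (sumFin-cong k (λ j → sumFin-*ˡ (n j) [ adjacent i j ] (λ b → z (j , b)))) ⟩
    + N i * z (i , a) - neighbourSum i z ∎

  layerSum : (ℕ → ℤ) → (ℕ → ℤ) → ℕ → ℤ
  layerSum x y j = + nAt k n (suc j) * x j + y j

  stencilAt : ℕ → Stencil
  stencilAt i = record
    { odd      = 2 ℕ.* i ℕ.∸ 1
    ; even     = 2 ℕ.* i
    ; right₁   = 2 ℕ.* i ℕ.+ 1
    ; right₂   = 2 ℕ.* i ℕ.+ 2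
    ; left₁    = 2 ℕ.* i ℕ.∸ 3
    ; left₂    = 2 ℕ.* i ℕ.∸ 2
    ; diag     = + NN k n i
    ; nRight   = + nAt k n (i ℕ.+ 1)
    ; nLeft    = + nAt k n (i ℕ.∸ 1)
    ; hasRight = ⌊ i ℕ.≤? k ℕ.∸ 1 ⌋
    ; hasLeft  = ⌊ 2 ℕ.≤? i ⌋
    }

  module Rows (x y : ℕ → ℤ) (x-beyond : ∀ h → ¬ h < k → x h ≡ + 0) (y-beyond : ∀ h → ¬ h < k → y h ≡ + 0) where

    c : ℕ → ℤ
    c = interleave x y

    S : ℕ → ℤ
    S = layerSum x y

    row : ℕ → ℤ
    row p = sumFin (2 ℕ.* k) (λ q → L3entry k n p (suc (toℕ q)) * c (toℕ q))

    row≡stencils : ∀ p → row p ≡ sumFin k (λ j → stencilValue (prev c) (stencilAt (suc (toℕ j))) p)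
    row≡stencils p = begin
      sumFin (2 ℕ.* k) (λ q → sumFin k (λ j → stencilEntry (stencilAt (suc (toℕ j))) p (suc (toℕ q))) * c (toℕ q))
        ≡⟨ sumFin-cong (2 ℕ.* k) (λ q → sym (sumFin-*ʳ k (c (toℕ q)) _)) ⟩
      sumFin (2 ℕ.* k) (λ q → sumFin k (λ j → stencilEntry (stencilAt (suc (toℕ j))) p (suc (toℕ q)) * c (toℕ q)))
        ≡⟨ sumFin-swap (2 ℕ.* k) k _ ⟩
      sumFin k (λ j → sumFin (2 ℕ.* k) (λ q → stencilEntry (stencilAt (suc (toℕ j))) p (suc (toℕ q)) * c (toℕ q)))
        ≡⟨ sumFin-cong k (λ j → stencil-sum (2 ℕ.* k) c (interleave-beyond k x-beyond y-beyond) (stencilAt (suc (toℕ j))) p) ⟩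
      sumFin k (λ j → stencilValue (prev c) (stencilAt (suc (toℕ j))) p) ∎

    S-beyond : ∀ j → ¬ j < k → S j ≡ + 0
    S-beyond j j≮k = begin
      + nAt k n (suc j) * x j + y j
        ≡⟨ cong₂ (λ a b → + nAt k n (suc j) * a + b) (x-beyond j j≮k) (y-beyond j j≮k) ⟩
      + nAt k n (suc j) * + 0 + + 0  ≡⟨ ℤP.+-identityʳ _ ⟩
      + nAt k n (suc j) * + 0        ≡⟨ ℤP.*-zeroʳ (+ nAt k n (suc j)) ⟩
      + 0                            ∎

    right-neighbour : ∀ h →
      [ ⌊ suc h ℕ.≤? k ℕ.∸ 1 ⌋ ] * (+ nAt k n (suc h ℕ.+ 1) * prev c (2 ℕ.* suc h ℕ.+ 1) + prev c (2 ℕ.* suc h ℕ.+ 2))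
        ≡ S (suc h)
    right-neighbour h = trans
      (cong (_*_ [ ⌊ suc h ℕ.≤? k ℕ.∸ 1 ⌋ ]) (cong₂ _+_
        (cong₂ _*_ (cong (λ t → + nAt k n t) (ℕP.+-comm (suc h) 1))
                   (trans (cong (prev c) (ℕP.+-comm (2 ℕ.* suc h) 1)) (interleave-even x y (suc h))))
        (trans (cong (prev c) (ℕP.+-comm (2 ℕ.* suc h) 2)) (interleave-odd x y (suc h)))))
      ([]-guard (suc h ℕ.≤? k ℕ.∸ 1) (S (suc h)) (λ h≰ → S-beyond (suc h) (h≰ ∘ ℕP.∸-monoˡ-≤ 1)))

    left-neighbour : ∀ h →
      [ ⌊ 2 ℕ.≤? suc h ⌋ ] * (+ nAt k n (suc h ℕ.∸ 1) * prev c (2 ℕ.* suc h ℕ.∸ 3) + prev c (2 ℕ.* suc h ℕ.∸ 2))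
        ≡ prev S h
    left-neighbour zero    = refl
    left-neighbour (suc h) = trans (ℤP.*-identityˡ _) (cong₂ _+_
      (cong (_*_ (+ nAt k n (suc h))) (trans (cong (prev c) left₁) (interleave-even x y h)))
      (trans (cong (prev c) left₂) (interleave-odd x y h)))
      where
      4+2h : 2 ℕ.* suc (suc h) ≡ 4 ℕ.+ 2 ℕ.* h
      4+2h = trans (ℕP.*-suc 2 (suc h)) (cong (2 ℕ.+_) (ℕP.*-suc 2 h))
      left₁ : 2 ℕ.* suc (suc h) ℕ.∸ 3 ≡ suc (2 ℕ.* h)
      left₁ = cong (λ t → t ℕ.∸ 3) 4+2h
      left₂ : 2 ℕ.* suc (suc h) ℕ.∸ 2 ≡ suc (suc (2 ℕ.* h))
      left₂ = cong (λ t → t ℕ.∸ 2) 4+2h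

    row-odd : ∀ i → row (suc (2 ℕ.* toℕ i)) ≡ + N i * x (toℕ i) - S (suc (toℕ i)) - prev S (toℕ i)
    row-odd i = begin
      row p
        ≡⟨ row≡stencils p ⟩
      sumFin k (λ j → stencilValue (prev c) (stencilAt (suc (toℕ j))) p)
        ≡⟨ sumFin-single k _ i off ⟩
      stencilValue (prev c) (stencilAt (suc h)) p
        ≡⟨ stencilValue-odd (prev c) (stencilAt (suc h)) p (==-true (sym (odd-position h)))
             (==-false λ e → ℕP.even≢odd h h (ℕP.suc-injective (trans e (even-position h)))) ⟩
      _ ≡⟨ cong₂ _-_ (cong₂ _-_ (cong (_*_ (+ N i)) (trans (cong (prev c) (odd-position h)) (interleave-even x y h)))
                               (right-neighbour h))
                    (left-neighbour h) ⟩
      + N i * x h - S (suc h) - prev S h ∎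
      where
      h = toℕ i
      p = suc (2 ℕ.* h)
      off : ∀ j → j ≢ i → stencilValue (prev c) (stencilAt (suc (toℕ j))) p ≡ + 0
      off j j≢i = stencilValue-off (prev c) (stencilAt (suc (toℕ j))) p
        (==-false λ e → j≢i (FP.toℕ-injective (sym
          (ℕP.*-cancelˡ-≡ h (toℕ j) 2 (ℕP.suc-injective (trans e (odd-position (toℕ j))))))))
        (==-false λ e → ℕP.even≢odd h (toℕ j) (ℕP.suc-injective (trans e (even-position (toℕ j)))))

    row-even : ∀ i → row (suc (suc (2 ℕ.* toℕ i))) ≡ + N i * y (toℕ i)
    row-even i = begin
      row p
        ≡⟨ row≡stencils p ⟩
      sumFin k (λ j → stencilValue (prev c) (stencilAt (suc (toℕ j))) p)
        ≡⟨ sumFin-single k _ i off ⟩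
      stencilValue (prev c) (stencilAt (suc h)) p
        ≡⟨ stencilValue-even (prev c) (stencilAt (suc h)) p
             (==-false λ e → ℕP.1+n≢n (ℕP.suc-injective (trans e (odd-position h))))
             (==-true (sym (even-position h))) ⟩
      + N i * prev c (2 ℕ.* suc h)
        ≡⟨ cong (_*_ (+ N i)) (trans (cong (prev c) (even-position h)) (interleave-odd x y h)) ⟩
      + N i * y h ∎
      where
      h = toℕ i
      p = suc (suc (2 ℕ.* h))
      off : ∀ j → j ≢ i → stencilValue (prev c) (stencilAt (suc (toℕ j))) p ≡ + 0
      off j j≢i = stencilValue-off (prev c) (stencilAt (suc (toℕ j))) p
        (==-false λ e → ℕP.even≢odd (toℕ j) h (sym (ℕP.suc-injective (trans e (odd-position (toℕ j))))))
        (==-false λ e → j≢i (FP.toℕ-injective (sym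
          (ℕP.*-cancelˡ-≡ h (toℕ j) 2 (ℕP.suc-injective (ℕP.suc-injective (trans e (even-position (toℕ j)))))))))

  image-Target₁ : ∀ w i j u → image Target w (inj₁ (i , (j , u))) ≡ + N i * w (inj₁ (i , (j , F.zero)))
  image-Target₁ w i j u = begin
    image Target w (inj₁ (i , (j , u)))
      ≡⟨ image-⊕₁ (⨁ k Blocks) (cokerMat (2 ℕ.* k) (L3 k n)) w (i , (j , u)) ⟩
    image (⨁ k Blocks) (λ r → w (inj₁ r)) (i , (j , u))
      ≡⟨ image-⨁ k Blocks i (j , u) (λ r → w (inj₁ r)) ⟩
    image (Blocks i) (λ b → w (inj₁ (i , b))) (j , u)
      ≡⟨ image-⨁ (n i ℕ.∸ 2) (λ _ → ZMod (N i)) j u (λ b → w (inj₁ (i , b))) ⟩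
    image (ZMod (N i)) (λ b → w (inj₁ (i , (j , b)))) u
      ≡⟨ image-ZMod (N i) (λ b → w (inj₁ (i , (j , b)))) u ⟩
    + N i * w (inj₁ (i , (j , F.zero))) ∎

  xs : (El V → ℤ) → ℕ → ℤ
  xs z = pad k (λ i → xCoord (n i) (λ a → z (i , a)))

  ys : (El V → ℤ) → ℕ → ℤ
  ys z = pad k (λ i → yCoord (n i) (λ a → z (i , a)))

  xs-beyond : ∀ z h → ¬ h < k → xs z h ≡ + 0
  xs-beyond z h = pad-≥ k _

  ys-beyond : ∀ z h → ¬ h < k → ys z h ≡ + 0
  ys-beyond z h = pad-≥ k _

  -- The generators of coker L₃ are ordered x₁, y₁, …, x_k, y_k.
  encode : Vec Lap → Vec Target
  encode z (inj₁ (i , (j , _))) = dCoord (n i) (λ a → z (i , a)) j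
  encode z (inj₂ q)             = interleave (xs z) (ys z) (toℕ q)

  l3Coord : Vec Target → ℕ → ℤ
  l3Coord w = pad (2 ℕ.* k) (λ q → w (inj₂ q))

  decode : Vec Target → Vec Lap
  decode w (i , a) =
    fromCoords (n i) (λ j → w (inj₁ (i , (j , F.zero)))) (l3Coord w (2 ℕ.* toℕ i)) (l3Coord w (suc (2 ℕ.* toℕ i))) a

  encode-ext : ∀ {z z′} → (∀ v → z v ≡ z′ v) → ∀ g → encode z g ≡ encode z′ g
  encode-ext z≗z′ (inj₁ (i , (j , _))) = dCoord-cong (n i) (λ a → z≗z′ (i , a)) j
  encode-ext z≗z′ (inj₂ q) = interleave-cong
    (pad-cong k (λ i → xCoord-cong (n i) (λ a → z≗z′ (i , a))))
    (pad-cong k (λ i → yCoord-cong (n i) (λ a → z≗z′ (i , a))))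
    (toℕ q)

  encode-+ : ∀ z z′ g → encode (λ v → z v + z′ v) g ≡ encode z g + encode z′ g
  encode-+ z z′ (inj₁ (i , (j , _))) = dCoord-+ (n i) _ _ j
  encode-+ z z′ (inj₂ q) = trans
    (interleave-cong (λ h → trans (pad-cong k (λ i → xCoord-+ (n i) _ _) h) (pad-+ k _ _ h))
                     (λ h → trans (pad-cong k (λ i → yCoord-+ (n i) _ _) h) (pad-+ k _ _ h))
                     (toℕ q))
    (interleave-+ (xs z) (ys z) (xs z′) (ys z′) (toℕ q))

  decode-ext : ∀ {w w′} → (∀ g → w g ≡ w′ g) → ∀ v → decode w v ≡ decode w′ v
  decode-ext w≗w′ (i , a) = fromCoords-cong (n i) (λ j → w≗w′ _) (l3Coord-cong _) (l3Coord-cong _) a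
    where l3Coord-cong = pad-cong (2 ℕ.* k) (λ q → w≗w′ (inj₂ q))

  l3Coord-encode : ∀ z p → l3Coord (encode z) p ≡ interleave (xs z) (ys z) p
  l3Coord-encode z = pad-∘toℕ (2 ℕ.* k) (interleave (xs z) (ys z)) (interleave-beyond k (xs-beyond z) (ys-beyond z))

  ys-image : ∀ z i → ys (image Lap z) (toℕ i) ≡ + N i * ys z (toℕ i)
  ys-image z i = begin
    ys (image Lap z) (toℕ i)                                   ≡⟨ pad-toℕ k _ i ⟩
    yCoord (n i) (λ a → image Lap z (i , a))                   ≡⟨ yCoord-cong (n i) (image-Lap z i) ⟩
    yCoord (n i) (λ a → + N i * z (i , a) - neighbourSum i z)  ≡⟨ yCoord-affine (n i) (+ N i) (neighbourSum i z) (λ a → z (i , a)) ⟩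
    + N i * yCoord (n i) (λ a → z (i , a))                     ≡⟨ cong (_*_ (+ N i)) (sym (pad-toℕ k _ i)) ⟩
    + N i * ys z (toℕ i)                                       ∎

  module _ (hn : ∀ i → 2 ≤ n i) where

    pad-partSum : ∀ z j → pad k (partSum z) j ≡ layerSum (xs z) (ys z) j
    pad-partSum z j with j ℕ.<? k
    ... | yes j<k = sym (sumFin-coords (n (F.fromℕ< j<k)) (hn _) _)
    ... | no  _   = refl

    xs-image : ∀ z i → let S = layerSum (xs z) (ys z) in
      xs (image Lap z) (toℕ i) ≡ + N i * xs z (toℕ i) - S (suc (toℕ i)) - prev S (toℕ i)
    xs-image z i = begin
      xs (image Lap z) (toℕ i)                                   ≡⟨ pad-toℕ k _ i ⟩
      xCoord (n i) (λ a → image Lap z (i , a))                   ≡⟨ xCoord-cong (n i) (image-Lap z i) ⟩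
      xCoord (n i) (λ a → + N i * z (i , a) - neighbourSum i z)  ≡⟨ xCoord-affine (n i) (hn i) (+ N i) (neighbourSum i z) (λ a → z (i , a)) ⟩
      + N i * xCoord (n i) (λ a → z (i , a)) - neighbourSum i z
        ≡⟨ cong₂ (λ a b → + N i * a - b) (sym (pad-toℕ k _ i)) (adjacent-sum i (partSum z)) ⟩
      + N i * xs z (toℕ i) - (pad k (partSum z) (suc (toℕ i)) + prev (pad k (partSum z)) (toℕ i))
        ≡⟨ cong (λ t → + N i * xs z (toℕ i) - t) (cong₂ _+_ (pad-partSum z (suc (toℕ i))) (prev-cong (pad-partSum z) (toℕ i))) ⟩
      + N i * xs z (toℕ i) - (S (suc (toℕ i)) + prev S (toℕ i))
        ≡⟨ sub-+ (+ N i * xs z (toℕ i)) (S (suc (toℕ i))) (prev S (toℕ i)) ⟩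
      + N i * xs z (toℕ i) - S (suc (toℕ i)) - prev S (toℕ i)  ∎
      where
      S = layerSum (xs z) (ys z)
      sub-+ : ∀ a b c → a - (b + c) ≡ a - b - c
      sub-+ = solve-∀

    encode-image : ∀ z g → encode (image Lap z) g ≡ image Target (encode z) g
    encode-image z (inj₁ (i , (j , u))) = begin
      dCoord (n i) (λ a → image Lap z (i , a)) j                   ≡⟨ dCoord-cong (n i) (image-Lap z i) j ⟩
      dCoord (n i) (λ a → + N i * z (i , a) - neighbourSum i z) j  ≡⟨ dCoord-affine (n i) (+ N i) (neighbourSum i z) (λ a → z (i , a)) j ⟩
      + N i * dCoord (n i) (λ a → z (i , a)) j                     ≡⟨ sym (image-Target₁ (encode z) i j u) ⟩
      image Target (encode z) (inj₁ (i , (j , u)))                 ∎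
    encode-image z (inj₂ q) = begin
      interleave (xs (image Lap z)) (ys (image Lap z)) (toℕ q)
        ≡⟨ interleave-≡ k {f = λ p → row (suc p)}
             (λ i → trans (xs-image z i) (sym (row-odd i)))
             (λ i → trans (ys-image z i) (sym (row-even i)))
             (toℕ q) (FP.toℕ<n q) ⟩
      row (suc (toℕ q))
        ≡⟨ sym (image-⊕₂ (⨁ k Blocks) (cokerMat (2 ℕ.* k) (L3 k n)) (encode z) q) ⟩
      image Target (encode z) (inj₂ q) ∎
      where open Rows (xs z) (ys z) (xs-beyond z) (ys-beyond z)

    decode∘encode : ∀ z v → decode (encode z) v ≡ z v
    decode∘encode z (i , a) = trans
      (fromCoords-cong (n i) (λ _ → refl)
        (trans (l3Coord-encode z _) (trans (interleave-even (xs z) (ys z) (toℕ i)) (pad-toℕ k _ i)))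
        (trans (l3Coord-encode z _) (trans (interleave-odd (xs z) (ys z) (toℕ i)) (pad-toℕ k _ i)))
        a)
      (fromCoords-coords (n i) (hn i) (λ a → z (i , a)) a)

    encode∘decode : ∀ w g → encode (decode w) g ≡ w g
    encode∘decode w (inj₁ (i , (j , F.zero))) = dCoord-fromCoords (n i) _ _ _ j
    encode∘decode w (inj₂ q) = trans
      (interleave-≡ k {f = l3Coord w}
        (λ i → trans (pad-toℕ k _ i) (xCoord-fromCoords (n i) (hn i) _ _ _))
        (λ i → trans (pad-toℕ k _ i) (yCoord-fromCoords (n i) (hn i) _ _ _))
        (toℕ q) (FP.toℕ<n q))
      (pad-toℕ (2 ℕ.* k) _ q)

    basisChange : BasisChange Lap Target
    basisChange = record
      { to            = encode
      ; from          = decode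
      ; toRel         = encode
      ; fromRel       = decode
      ; to-ext        = encode-ext
      ; from-ext      = decode-ext
      ; to-+          = encode-+
      ; from∘to       = decode∘encode
      ; to∘from       = encode∘decode
      ; toRel∘fromRel = encode∘decode
      ; to-image      = encode-image
      }

mainTheorem1 : (k : ℕ) → 2 ≤ k → (n : Fin k → ℕ) → (∀ i → 2 ≤ n i) →
    lapPres (Gverts k n) (Gadj k n)
      ≅ (⨁ k (λ i → ZMod (NN k n (suc (toℕ i))) ^⊕ (n i ℕ.∸ 2))
          ⊕ cokerMat (2 ℕ.* k) (L3 k n))
mainTheorem1 k _ n hn = basisChange⇒≅ (Layered.basisChange k n hn)
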